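{- If $G$ is an appended star of order $n$, of maximum degree $3$ and of diameter at least $8$, then $\gamma^{\rm ID}(G)\le\frac23 n$.
   Context: A $\Delta$-star is $K_{1,\Delta}$. $G'\rhd_v S$ denotes the graph obtained from the disjoint union of $G'$ and a star $S$ by identifying the vertex $v$ of $G'$ with a leaf of $S$. An appended star is a graph $G_p$ where $p\ge1$, $G_0=S_0$ is a $\Delta_0$-star with $\Delta_0\ge3$, and $G_i=G_{i-1}\rhd_{v_{i-1}}S_i$ for $i=1,\dots,p$, with $S_i$ a $\Delta_i$-star, $\Delta_i\ge3$, and $v_{i-1}$ a vertex of $G_{i-1}$. An identifying code of $G$ is a set $C\subseteq V(G)$ such that every vertex $v$ satisfies $N[v]\cap C\neq\emptyset$ and distinct vertices $u,v$ satisfy $N[u]\cap C\neq N[v]\cap C$, where $N[v]$ is the closed neighborhood; $\gamma^{\rm ID}(G)$ is its minimum size. -}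

module Defs where

open import Data.Nat using (ℕ; zero; suc; _+_; _*_; _≤_)
open import Data.Bool using (Bool; true; false; _∧_; _∨_; _xor_)
open import Data.Fin using (Fin; zero; suc; splitAt)
open import Data.Fin.Properties using (_≟_)
open import Data.Fin.Subset using (Subset; _∩_; ∣_∣; Nonempty)
open import Data.Vec using (tabulate)
open import Data.Sum using (inj₁; inj₂)
open import Data.Product using (Σ; ∃; ∃-syntax; _×_)
open import Relation.Nullary using (¬_)
open import Data.Unit using (⊤)
open import Relation.Nullary.Decidable using (⌊_⌋)
open import Relation.Binary.PropositionalEquality using (_≡_; _≢_)
open import Function.Bundles using (_↔_; Inverse)

Adj : ℕ → Set
Adj n = Fin n → Fin n → Bool

starAdj : (Δ : ℕ) → Adj (suc Δ)
starAdj Δ zero    zero    = false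
starAdj Δ zero    (suc _) = true
starAdj Δ (suc _) zero    = true
starAdj Δ (suc _) (suc _) = false

isCentre : ∀ {Δ} → Fin Δ → Bool
isCentre zero    = true
isCentre (suc _) = false

-- G' ▷_v S for S a Δ-star: the leaf of S identified with v is v itself;
-- the remaining Δ vertices of S (its centre, first, and Δ-1 other leaves)
-- are the new vertices n, ..., n+Δ-1.
appendAdj : ∀ {n} → Adj n → Fin n → (Δ : ℕ) → Adj (n + Δ)
appendAdj {n} A v Δ x y with splitAt n x | splitAt n y
... | inj₁ a | inj₁ b = A a b
... | inj₁ a | inj₂ k = isCentre k ∧ ⌊ a ≟ v ⌋
... | inj₂ k | inj₁ b = isCentre k ∧ ⌊ b ≟ v ⌋
... | inj₂ k | inj₂ l = isCentre k xor isCentre l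

-- ConstructedAS p n A : A on Fin n is (a labelled copy of) G_p in the
-- appended-star construction.
data ConstructedAS : ℕ → (n : ℕ) → Adj n → Set where
  base : ∀ Δ → 3 ≤ Δ → ConstructedAS 0 (suc Δ) (starAdj Δ)
  step : ∀ {p n A} → ConstructedAS p n A → (v : Fin n) → ∀ Δ → 3 ≤ Δ →
         ConstructedAS (suc p) (n + Δ) (appendAdj A v Δ)

IsAppendedStar : (n : ℕ) → Adj n → Set
IsAppendedStar n A =
  ∃[ p ] (1 ≤ p × ∃[ A′ ] (ConstructedAS p n A′ ×
     Σ (Fin n ↔ Fin n) (λ σ → ∀ u w → A u w ≡ A′ (Inverse.to σ u) (Inverse.to σ w))))

deg : ∀ {n} → Adj n → Fin n → ℕ
deg A v = ∣ tabulate (A v) ∣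

MaxDegree : ∀ {n} → Adj n → ℕ → Set
MaxDegree {n} A d = (∀ v → deg A v ≤ d) × ∃[ v ] (deg A v ≡ d)

-- Walk k u v : there is a walk from u to v of length at most k.
data Walk {n} (A : Adj n) : ℕ → Fin n → Fin n → Set where
  here : ∀ {k u} → Walk A k u u
  next : ∀ {k u w v} → A u w ≡ true → Walk A k w v → Walk A (suc k) u v

-- diameter ≥ d: some pair of vertices at distance ≥ d, i.e. not joined by
-- a walk of length ≤ d - 1.
DiameterAtLeast : ∀ {n} → Adj n → ℕ → Set
DiameterAtLeast A zero    = ⊤
DiameterAtLeast A (suc d) = ∃[ u ] ∃[ v ] ¬ Walk A d u v

closedNbhd : ∀ {n} → Adj n → Fin n → Subset n
closedNbhd A v = tabulate (λ u → ⌊ u ≟ v ⌋ ∨ A v u)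

IsIdentifyingCode : ∀ {n} → Adj n → Subset n → Set
IsIdentifyingCode A C =
  (∀ v → Nonempty (closedNbhd A v ∩ C)) ×
  (∀ u v → u ≢ v → closedNbhd A u ∩ C ≢ closedNbhd A v ∩ C)

-- γ^ID(G) ≤ k/m : some identifying code C with m·|C| ≤ k (γ^ID is an integer minimum)
γID-atMost : ∀ {n} → Adj n → ℕ → ℕ → Set
γID-atMost A k m = ∃[ C ] (IsIdentifyingCode A C × m * ∣ C ∣ ≤ k)

-- Since the maximum degree is 3, every star of the construction is a claw attached at a vertex
-- that is not yet a centre, so G is a tree whose c centres have exactly three neighbours, all of
-- them non-centres, and n = 3c + 1.  The 2c + 1 non-centres already form an identifying code: a
-- non-centre sees only itself, a centre its three neighbours.  To save one vertex, take a path
-- s₀ … s₈ starting at a non-centre (it exists since the diameter is at least 8) together with the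
-- third neighbours of its centres s₁, s₃, s₅, s₇.  On this caterpillar use the spine vertices
-- other than s₄ instead of its nine non-centres.  A finite check shows that the new code still
-- separates the vertices of the caterpillar; outside it nothing changes, because G has no cycles
-- and so no vertex outside the caterpillar has two neighbours on it.  The code has 2c elements,
-- so 3 |C| ≤ 2n.

module Submission where

open import Defs
open import Data.Nat using (ℕ; zero; suc; _+_; _*_; _∸_; _≤_; _<_; z≤n; s≤s)
import Data.Nat as ℕ
open import Data.Nat.Properties hiding (_≟_; suc-injective; 0≢1+n)
import Data.Nat.Properties as ℕₚ
open import Data.Nat.Induction using (<-rec)
open import Data.Bool using (Bool; true; false; not; _∧_; _∨_; _xor_; if_then_else_)
import Data.Bool as Bool
open import Data.Bool.Properties using (not-involutive; ∨-zeroʳ; xor-comm)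
open import Data.Fin using (Fin; zero; suc; toℕ; fromℕ<; #_; _↑ˡ_; _↑ʳ_; splitAt; join)
open import Data.Fin.Properties using (_≟_; suc-injective; 0≢1+n; all?; any?; toℕ<n; toℕ-injective; toℕ-fromℕ<; splitAt-↑ˡ; splitAt-↑ʳ; splitAt-join; join-splitAt; ↑ˡ-injective; ↑ʳ-injective)
open import Data.Fin.Subset using (Subset; _∩_; ∣_∣; ∁; Nonempty)
open import Data.Fin.Subset.Properties using (∣p∣≤n; ∣∁p∣≡n∸∣p∣)
open import Data.Vec using (_∷_; []; tabulate; lookup)
open import Data.Vec.Properties using (tabulate-cong; tabulate-∘; lookup∘tabulate; lookup-zipWith; lookup⇒[]=)
open import Data.Vec.Functional using (_++_)
open import Data.Vec.Functional.Properties using (lookup-++ˡ; lookup-++ʳ)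
open import Data.Product using (Σ-syntax; ∃-syntax; _×_; _,_; proj₁; proj₂)
open import Data.Sum using (_⊎_; inj₁; inj₂)
import Data.Sum as Sum
open import Data.Empty using (⊥; ⊥-elim)
open import Function using (_∘_)
open import Function.Bundles using (_↔_; Inverse; Injection)
open import Function.Definitions using (Injective)
open import Function.Properties.Inverse using (↔⇒↣; ↔-sym)
open import Relation.Nullary using (¬_; Dec; yes; no; does; contradiction)
open import Relation.Nullary.Decidable using (⌊_⌋; isYes≗does; dec-true; dec-false; from-yes)
open import Relation.Nullary.Decidable using (¬?; _→-dec_; _×-dec_; _⊎-dec_)
open import Relation.Binary.PropositionalEquality
open import Relation.Binary.Definitions using (tri<; tri≈; tri>)

-- Counting the true entries of Boolean vectors

∣tabulate∣-cong : ∀ {n} {f g : Fin n → Bool} → (∀ x → f x ≡ g x) → ∣ tabulate f ∣ ≡ ∣ tabulate g ∣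
∣tabulate∣-cong f≗g = cong ∣_∣ (tabulate-cong f≗g)

∣tabulate-true∣ : ∀ n → ∣ tabulate {n = n} (λ _ → true) ∣ ≡ n
∣tabulate-true∣ zero    = refl
∣tabulate-true∣ (suc n) = cong suc (∣tabulate-true∣ n)

∣tabulate∣+∣tabulate-not∣ : ∀ {n} (f : Fin n → Bool) → ∣ tabulate f ∣ + ∣ tabulate (not ∘ f) ∣ ≡ n
∣tabulate∣+∣tabulate-not∣ {n} f = begin
  ∣ tabulate f ∣ + ∣ tabulate (not ∘ f) ∣ ≡⟨ cong (λ p → ∣ tabulate f ∣ + ∣ p ∣) (tabulate-∘ not f) ⟩
  ∣ tabulate f ∣ + ∣ ∁ (tabulate f) ∣     ≡⟨ cong (∣ tabulate f ∣ +_) (∣∁p∣≡n∸∣p∣ (tabulate f)) ⟩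
  ∣ tabulate f ∣ + (n ∸ ∣ tabulate f ∣)   ≡⟨ m+[n∸m]≡n (∣p∣≤n (tabulate f)) ⟩
  n                                       ∎
  where open ≡-Reasoning

-- does rather than ⌊_⌋, so that delete (f ∘ suc) x and delete f (suc x) agree definitionally
delete : ∀ {n} → (Fin n → Bool) → Fin n → Fin n → Bool
delete f x y = if does (y ≟ x) then false else f y

∣tabulate∣-delete : ∀ {n} (f : Fin n → Bool) {x} → f x ≡ true →
                    ∣ tabulate f ∣ ≡ suc ∣ tabulate (delete f x) ∣
∣tabulate∣-delete f {zero}  fx rewrite fx = refl
∣tabulate∣-delete f {suc x} fx with f zero
... | true  = cong suc (∣tabulate∣-delete (f ∘ suc) {x} fx)
... | false = ∣tabulate∣-delete (f ∘ suc) {x} fx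

delete-≢ : ∀ {n} (f : Fin n → Bool) {x y} → y ≢ x → delete f x y ≡ f y
delete-≢ f {x} {y} y≢x with y ≟ x
... | yes y≡x = contradiction y≡x y≢x
... | no  _   = refl

1≤∣tabulate∣ : ∀ {n} {f : Fin n → Bool} {x} → f x ≡ true → 1 ≤ ∣ tabulate f ∣
1≤∣tabulate∣ {f = f} fx = subst (1 ≤_) (sym (∣tabulate∣-delete f fx)) (s≤s z≤n)

∣tabulate∣-mono-injection : ∀ {m n} {f : Fin m → Bool} {g : Fin n → Bool} (e : Fin m → Fin n) →
                            Injective _≡_ _≡_ e → (∀ i → f i ≡ true → g (e i) ≡ true) →
                            ∣ tabulate f ∣ ≤ ∣ tabulate g ∣
∣tabulate∣-mono-injection {zero}  e inj f⇒g = z≤n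
∣tabulate∣-mono-injection {suc m} {f = f} {g} e inj f⇒g with f zero in f₀
... | false = ∣tabulate∣-mono-injection (e ∘ suc) (suc-injective ∘ inj) (f⇒g ∘ suc)
... | true  = begin
  suc ∣ tabulate (f ∘ suc) ∣             ≤⟨ s≤s (∣tabulate∣-mono-injection (e ∘ suc) (suc-injective ∘ inj) f⇒g′) ⟩
  suc ∣ tabulate (delete g (e zero)) ∣   ≡⟨ ∣tabulate∣-delete g (f⇒g zero f₀) ⟨
  ∣ tabulate g ∣                         ∎
  where
  open ≤-Reasoning
  f⇒g′ : ∀ i → f (suc i) ≡ true → delete g (e zero) (e (suc i)) ≡ true
  f⇒g′ i fᵢ = trans (delete-≢ g (λ eq → 0≢1+n (sym (inj eq)))) (f⇒g (suc i) fᵢ)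

≤∣tabulate∣ : ∀ {k n} {g : Fin n → Bool} (e : Fin k → Fin n) →
              Injective _≡_ _≡_ e → (∀ i → g (e i) ≡ true) → k ≤ ∣ tabulate g ∣
≤∣tabulate∣ {k} e inj g∘e = subst (_≤ _) (∣tabulate-true∣ k) (∣tabulate∣-mono-injection e inj (λ i _ → g∘e i))

∣tabulate∣-permute : ∀ {n} (σ : Fin n ↔ Fin n) (f : Fin n → Bool) →
                     ∣ tabulate (f ∘ Inverse.to σ) ∣ ≡ ∣ tabulate f ∣
∣tabulate∣-permute σ f = ≤-antisym
  (∣tabulate∣-mono-injection to (Injection.injective (↔⇒↣ σ)) (λ _ fx → fx))
  (∣tabulate∣-mono-injection from (Injection.injective (↔⇒↣ (↔-sym σ)))
                             (λ x fx → trans (cong f (strictlyInverseˡ x)) fx))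
  where open Inverse σ

∣tabulate∣-++ : ∀ {n m} (f : Fin (n + m) → Bool) →
                ∣ tabulate f ∣ ≡ ∣ tabulate (f ∘ (_↑ˡ m)) ∣ + ∣ tabulate (f ∘ (n ↑ʳ_)) ∣
∣tabulate∣-++ {zero}      f = refl
∣tabulate∣-++ {suc n} {m} f with f zero
... | true  = cong suc (∣tabulate∣-++ {n} {m} (f ∘ suc))
... | false = ∣tabulate∣-++ {n} {m} (f ∘ suc)

-- Walks and distances

module _ {n} (A : Adj n) where

  walk-mono : ∀ {k k′ x y} → k ≤ k′ → Walk A k x y → Walk A k′ x y
  walk-mono _         here        = here
  walk-mono (s≤s k≤k′) (next e w) = next e (walk-mono k≤k′ w)

  walk-++ : ∀ {a b x y z} → Walk A a x y → Walk A b y z → Walk A (a + b) x z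
  walk-++ {a} {b} here w′ = walk-mono (m≤n+m b a) w′
  walk-++ (next e w) w′   = next e (walk-++ w w′)

  walk-∷ʳ : ∀ {k x y z} → Walk A k x y → A y z ≡ true → Walk A (suc k) x z
  walk-∷ʳ here       e = next e here
  walk-∷ʳ (next e′ w) e = next e′ (walk-∷ʳ w e)

  walk? : ∀ k x y → Dec (Walk A k x y)
  walk? k x y with x ≟ y
  ... | yes refl = yes here
  walk? zero    x y | no x≢y = no λ { here → x≢y refl }
  walk? (suc k) x y | no x≢y with any? (λ w → (A x w Bool.≟ true) ×-dec walk? k w y)
  ... | yes (w , e , p) = yes (next e p)
  ... | no ∄w = no λ { here → x≢y refl ; (next e p) → ∄w (_ , e , p) }

  Distance : ℕ → Fin n → Fin n → Set
  Distance d x y = Walk A d x y × (∀ {j} → j < d → ¬ Walk A j x y)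

  distance : ∀ {k x y} → Walk A k x y → ∃[ d ] Distance d x y
  distance {zero}          w = zero , w , λ ()
  distance {suc k} {x} {y} w with walk? k x y
  ... | yes w′ = distance w′
  ... | no ¬w′ = suc k , w , λ j<1+k w″ → ¬w′ (walk-mono (≤-pred j<1+k) w″)

  ¬walk⇒<distance : ∀ {k d x y} → ¬ Walk A k x y → Distance d x y → k < d
  ¬walk⇒<distance ¬w (w , _) = ≰⇒> λ d≤k → ¬w (walk-mono d≤k w)

  distance-step : ∀ {d x y} → Distance (suc d) x y → ∃[ w ] (A x w ≡ true × Distance d w y)
  distance-step (here     , shortest) = contradiction here (shortest (s≤s z≤n))
  distance-step (next e w , shortest) = _ , e , w , λ j<d w′ → shortest (s≤s j<d) (next e w′)

  distance-unique : ∀ {a b x y} → Distance a x y → Distance b x y → a ≡ b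
  distance-unique {a} {b} (wa , sa) (wb , sb) with <-cmp a b
  ... | tri< a<b _ _ = contradiction wa (sb a<b)
  ... | tri≈ _ a≡b _ = a≡b
  ... | tri> _ _ b<a = contradiction wb (sa b<a)

  data WalkWithin (P : Fin n → Set) : Fin n → Fin n → Set where
    stop : ∀ {x} → P x → WalkWithin P x x
    hop  : ∀ {x y z} → P x → A x y ≡ true → WalkWithin P y z → WalkWithin P x z

  module _ {P : Fin n → Set} where

    walkWithin-head : ∀ {x y} → WalkWithin P x y → P x
    walkWithin-head (stop p)    = p
    walkWithin-head (hop p _ _) = p

    walkWithin-++ : ∀ {x y z} → WalkWithin P x y → WalkWithin P y z → WalkWithin P x z
    walkWithin-++ (stop _)    w′ = w′
    walkWithin-++ (hop p e w) w′ = hop p e (walkWithin-++ w w′)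

    walkWithin-map : ∀ {Q : Fin n → Set} → (∀ {x} → P x → Q x) → ∀ {x y} → WalkWithin P x y → WalkWithin Q x y
    walkWithin-map f (stop p)    = stop (f p)
    walkWithin-map f (hop p e w) = hop (f p) e (walkWithin-map f w)

  -- walks w 0, w 1, …, w m as ℕ-indexed sequences, for index arithmetic along a path
  IsWalk : (ℕ → Fin n) → ℕ → Set
  IsWalk w m = ∀ t → t < m → A (w t) (w (suc t)) ≡ true

  NonBacktracking : (ℕ → Fin n) → ℕ → Set
  NonBacktracking w m = ∀ t → 2 + t ≤ m → w t ≢ w (2 + t)

  isWalk-shift : ∀ {w m} a {d} → d + a ≤ m → IsWalk w m → IsWalk (λ t → w (t + a)) d
  isWalk-shift a d+a≤m walk t t<d = walk (t + a) (≤-trans (+-monoˡ-< a t<d) d+a≤m)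

  walkWithin-seq : ∀ {P w} m → IsWalk w m → (∀ t → t ≤ m → P (w t)) → WalkWithin P (w 0) (w m)
  walkWithin-seq zero    _    p = stop (p 0 z≤n)
  walkWithin-seq (suc m) walk p = hop (p 0 z≤n) (walk 0 (s≤s z≤n))
    (walkWithin-seq m (λ t t<m → walk (suc t) (s≤s t<m)) (λ t t≤m → p (suc t) (s≤s t≤m)))

  geodesic : ∀ d {x y} → Distance d x y → ℕ → Fin n
  geodesic _       {x} _    zero    = x
  geodesic zero    {x} _    (suc _) = x
  geodesic (suc d)     dist (suc t) = geodesic d (proj₂ (proj₂ (distance-step dist))) t

  geodesic-distance : ∀ d {x y} (dist : Distance d x y) t → t ≤ d → Distance (d ∸ t) (geodesic d dist t) y
  geodesic-distance d       dist zero    _         = dist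
  geodesic-distance (suc d) dist (suc t) (s≤s t≤d) = geodesic-distance d _ t t≤d

  geodesic-walk : ∀ d {x y} (dist : Distance d x y) → IsWalk (geodesic d dist) d
  geodesic-walk (suc d) dist zero    _         = proj₁ (proj₂ (distance-step dist))
  geodesic-walk (suc d) dist (suc t) (s≤s t<d) = geodesic-walk d _ t t<d

  geodesic-non-backtracking : ∀ d {x y} (dist : Distance d x y) → NonBacktracking (geodesic d dist) d
  geodesic-non-backtracking d dist t 2+t≤d eq = <-irrefl same-distance (∸-monoʳ-< (m<n+m t (s≤s z≤n)) 2+t≤d)
    where
    same-distance : d ∸ (2 + t) ≡ d ∸ t
    same-distance = distance-unique (geodesic-distance d dist (2 + t) 2+t≤d)
                    (subst (λ z → Distance (d ∸ t) z _) eq (geodesic-distance d dist t (≤-trans (m≤n+m t 2) 2+t≤d)))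

module _ {n} (A : Adj n) (symmetric : ∀ x y → A x y ≡ A y x) where

  walk-reverse : ∀ {k x y} → Walk A k x y → Walk A k y x
  walk-reverse here               = here
  walk-reverse {suc k} (next e w) = walk-∷ʳ A (walk-reverse w) (trans (symmetric _ _) e)

  walkWithin-reverse : ∀ {P x y} → WalkWithin A P x y → WalkWithin A P y x
  walkWithin-reverse (stop p)    = stop p
  walkWithin-reverse (hop p e w) =
    walkWithin-++ A (walkWithin-reverse w) (hop (walkWithin-head A w) (trans (symmetric _ _) e) (stop p))

-- Rooted trees

-- A tree presented by ranks: every vertex except the root has exactly one lower neighbour, its parent.
record RootedTree {n} (A : Adj n) : Set where
  field
    symmetric       : ∀ x y → A x y ≡ A y x
    rank            : Fin n → ℕ
    root            : Fin n
    parent          : Fin n → Fin n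
    edge-rank       : ∀ {x y} → A x y ≡ true → rank x < rank y ⊎ rank y < rank x
    lower-is-parent : ∀ {x y} → A x y ≡ true → rank y < rank x → parent x ≡ y
    to-parent       : ∀ x → x ≡ root ⊎ (A x (parent x) ≡ true × rank (parent x) < rank x)

module RootedTreeProperties {n} {A : Adj n} (T : RootedTree A) where
  open RootedTree T

  adjacent⇒≢ : ∀ {x y} → A x y ≡ true → x ≢ y
  adjacent⇒≢ e refl with edge-rank e
  ... | inj₁ r<r = <-irrefl refl r<r
  ... | inj₂ r<r = <-irrefl refl r<r

  lower-unique : ∀ {x y y′} → A x y ≡ true → A x y′ ≡ true → rank y < rank x → rank y′ < rank x → y ≡ y′
  lower-unique e e′ y<x y′<x = trans (sym (lower-is-parent e y<x)) (lower-is-parent e′ y′<x)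

  walk-to-root : ∀ k x → rank x ≤ k → ∃[ d ] Walk A d x root
  walk-to-root k x x≤k with to-parent x
  ... | inj₁ refl = zero , here
  walk-to-root zero    x x≤0   | inj₂ (_ , p<x) = contradiction (≤-trans p<x x≤0) λ ()
  walk-to-root (suc k) x x≤1+k | inj₂ (e , p<x) with walk-to-root k (parent x) (≤-pred (≤-trans p<x x≤1+k))
  ... | d , w = suc d , next e w

  connected : ∀ x y → ∃[ d ] Walk A d x y
  connected x y with walk-to-root (rank x) x ≤-refl | walk-to-root (rank y) y ≤-refl
  ... | _ , wx | _ , wy = _ , walk-++ A wx (walk-reverse A symmetric wy)

  data Ascending (a : Fin n) : Fin n → Set where
    start : Ascending a a
    climb : ∀ {y z} → Ascending a y → A y z ≡ true → rank y < rank z → Ascending a z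

  ascending-rank : ∀ {a b} → Ascending a b → a ≡ b ⊎ rank a < rank b
  ascending-rank start = inj₁ refl
  ascending-rank (climb asc _ y<z) with ascending-rank asc
  ... | inj₁ refl = inj₂ y<z
  ... | inj₂ a<y  = inj₂ (<-trans a<y y<z)

  -- A downward step from a vertex above a either retraces the climb or leads from a to its parent x.
  walk-stays-above : ∀ {a x y b} → A a x ≡ true → rank x < rank a →
                     Ascending a y → WalkWithin A (_≢ x) y b → Ascending a b
  walk-stays-above ax x<a asc (stop _) = asc
  walk-stays-above ax x<a asc (hop _ e w) with edge-rank e
  ... | inj₁ y<z = walk-stays-above ax x<a (climb asc e y<z) w
  ... | inj₂ z<y = walk-stays-above ax x<a (descend asc) w
    where
    descend : Ascending _ _ → Ascending _ _
    descend start = contradiction (lower-unique e ax z<y x<a) (walkWithin-head A w)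
    descend (climb asc′ e′ w<y) with lower-unique (trans (symmetric _ _) e′) e w<y z<y
    ... | refl = asc′

  private
    detour-from-above : ∀ {x a b} → a ≢ b → A x a ≡ true → rank x < rank a → A x b ≡ true →
                        WalkWithin A (_≢ x) a b → ⊥
    detour-from-above a≢b xa x<a xb w with walk-stays-above (trans (symmetric _ _) xa) x<a start w
    ... | start = a≢b refl
    ... | climb asc e y<b with edge-rank xb
    ...   | inj₂ b<x with ascending-rank (climb asc e y<b)
    ...     | inj₁ a≡b = a≢b a≡b
    ...     | inj₂ a<b = <-asym a<b (<-trans b<x x<a)
    detour-from-above a≢b xa x<a xb w | climb asc e y<b | inj₁ x<b
      with lower-unique (trans (symmetric _ _) e) (trans (symmetric _ _) xb) y<b x<b
    ... | refl with ascending-rank asc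
    ...   | inj₁ refl = adjacent⇒≢ xa refl
    ...   | inj₂ a<x  = <-asym a<x x<a

  no-detour : ∀ {x a b} → a ≢ b → A x a ≡ true → A x b ≡ true → WalkWithin A (_≢ x) a b → ⊥
  no-detour a≢b xa xb w with edge-rank xa | edge-rank xb
  ... | inj₁ x<a | _        = detour-from-above a≢b xa x<a xb w
  ... | inj₂ _   | inj₁ x<b = detour-from-above (a≢b ∘ sym) xb x<b xa (walkWithin-reverse A symmetric w)
  ... | inj₂ a<x | inj₂ b<x = a≢b (lower-unique xa xb a<x b<x)

  -- Closing up a repetition w 0 = w d would give a detour from w 1 to w (d - 1) around w 0;
  -- the shorter repetitions excluded inductively make that walk avoid w 0.
  non-backtracking-distinct : ∀ d {w m} → IsWalk A w m → NonBacktracking A w m → 0 < d → d ≤ m → w 0 ≢ w d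
  non-backtracking-distinct = <-rec EndsDistinct distinct
    where
    EndsDistinct : ℕ → Set
    EndsDistinct d = ∀ {w m} → IsWalk A w m → NonBacktracking A w m → 0 < d → d ≤ m → w 0 ≢ w d
    distinct : ∀ d → (∀ {d′} → d′ < d → EndsDistinct d′) → EndsDistinct d
    distinct 0 _ _ _ () _
    distinct 1 _ walk _ _ 1≤m = adjacent⇒≢ (walk 0 1≤m)
    distinct 2 _ _ nb _ 2≤m = nb 0 2≤m
    distinct (suc (suc (suc e))) shorter {w} walk nb _ d≤m w₀≡w₃₊ₑ =
      no-detour w₁≢w₂₊ₑ (walk 0 (≤-trans (s≤s z≤n) d≤m)) w₀w₂₊ₑ (walkWithin-seq A (suc e) (restrict walk′) avoids)
      where
      walk′ : IsWalk A (w ∘ suc) (2 + e)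
      walk′ t t<2+e = walk (suc t) (≤-trans (s≤s t<2+e) d≤m)
      restrict : IsWalk A (w ∘ suc) (2 + e) → IsWalk A (w ∘ suc) (suc e)
      restrict walk″ t t<1+e = walk″ t (m<n⇒m<1+n t<1+e)
      nb′ : NonBacktracking A (w ∘ suc) (2 + e)
      nb′ t 2+t≤2+e = nb (suc t) (≤-trans (s≤s 2+t≤2+e) d≤m)
      w₁≢w₂₊ₑ : w 1 ≢ w (2 + e)
      w₁≢w₂₊ₑ = shorter (m<n⇒m<1+n (n<1+n (suc e))) walk′ nb′ (s≤s z≤n) (n≤1+n _)
      w₀w₂₊ₑ : A (w 0) (w (2 + e)) ≡ true
      w₀w₂₊ₑ = trans (cong (λ x → A x (w (2 + e))) w₀≡w₃₊ₑ) (trans (symmetric _ _) (walk (2 + e) d≤m))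
      avoids : ∀ t → t ≤ suc e → w (suc t) ≢ w 0
      avoids t t≤1+e = shorter (s≤s (s≤s t≤1+e)) walk nb (s≤s z≤n) (≤-trans (s≤s (m≤n⇒m≤1+n t≤1+e)) d≤m) ∘ sym

  non-backtracking-injective : ∀ {w m} → IsWalk A w m → NonBacktracking A w m →
                               ∀ {i j} → i < j → j ≤ m → w i ≢ w j
  non-backtracking-injective {w} {m} walk nb {i} {j} i<j j≤m eq =
    non-backtracking-distinct (j ∸ i) walk′ nb′ (m<n⇒0<n∸m i<j) (∸-monoˡ-≤ i j≤m)
      (trans eq (cong w (sym (m∸n+n≡m (<⇒≤ i<j)))))
    where
    i≤m = ≤-trans (<⇒≤ i<j) j≤m
    walk′ : IsWalk A (λ t → w (t + i)) (m ∸ i)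
    walk′ = isWalk-shift A i (≤-reflexive (m∸n+n≡m i≤m)) walk
    nb′ : NonBacktracking A (λ t → w (t + i)) (m ∸ i)
    nb′ t 2+t≤ = nb (t + i) (≤-trans (+-monoˡ-≤ i 2+t≤) (≤-reflexive (m∸n+n≡m i≤m)))

  non-backtracking-chordless : ∀ {w m} → IsWalk A w m → NonBacktracking A w m →
                               ∀ {i j} → i < j → j ≤ m → A (w i) (w j) ≡ true → j ≡ suc i
  non-backtracking-chordless {w} {m} walk nb {i} {j} i<j j≤m e with j ℕ.≟ suc i
  ... | yes j≡1+i = j≡1+i
  ... | no  j≢1+i = ⊥-elim (no-detour a≢b (walk i (≤-trans i<j j≤m)) e detour)
    where
    1+i<j : suc i < j
    1+i<j = ≤∧≢⇒< i<j (j≢1+i ∘ sym)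
    a≢b : w (suc i) ≢ w j
    a≢b = non-backtracking-injective walk nb 1+i<j j≤m
    1+i≤j = <⇒≤ 1+i<j
    avoids : ∀ t → t ≤ j ∸ suc i → w (t + suc i) ≢ w i
    avoids t t≤ = ≢-sym (non-backtracking-injective walk nb (<-≤-trans (n<1+n i) (m≤n+m (suc i) t))
                          (≤-trans (+-monoˡ-≤ (suc i) t≤) (≤-trans (≤-reflexive (m∸n+n≡m 1+i≤j)) j≤m)))
    detour : WalkWithin A (_≢ w i) (w (suc i)) (w j)
    detour = subst (WalkWithin A _ (w (suc i))) (cong w (m∸n+n≡m 1+i≤j))
      (walkWithin-seq A (j ∸ suc i) (isWalk-shift A (suc i) (≤-trans (≤-reflexive (m∸n+n≡m 1+i≤j)) j≤m) walk) avoids)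

-- Appended stars of maximum degree 3

record ThreeNeighbours {n} (A : Adj n) (c : Fin n) : Set where
  field
    neighbour           : Fin 3 → Fin n
    neighbour-injective : Injective _≡_ _≡_ neighbour
    neighbour-adjacent  : ∀ i → A c (neighbour i) ≡ true
    neighbour-complete  : ∀ {y} → A c y ≡ true → ∃[ i ] neighbour i ≡ y

fin3-third : ∀ (i j : Fin 3) → i ≢ j → ∃[ k ] (k ≢ i × k ≢ j × ∀ l → l ≡ i ⊎ l ≡ j ⊎ l ≡ k)
fin3-third = from-yes (all? λ (i : Fin 3) → all? λ (j : Fin 3) → ¬? (i ≟ j) →-dec any? λ (k : Fin 3) →
               ¬? (k ≟ i) ×-dec ¬? (k ≟ j) ×-dec all? λ (l : Fin 3) → (l ≟ i) ⊎-dec (l ≟ j) ⊎-dec (l ≟ k))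

fin3-two-outside : ∀ {P : Fin 3 → Set} → (∀ i → Dec (P i)) → (∀ {i j} → P i → P j → i ≡ j) →
                   Σ[ i ∈ Fin 3 ] Σ[ j ∈ Fin 3 ] (i ≢ j × ¬ P i × ¬ P j)
fin3-two-outside P? unique with P? (# 0) | P? (# 1)
... | yes p₀ | yes p₁ = contradiction (unique p₀ p₁) λ ()
... | yes p₀ | no ¬p₁ = # 1 , # 2 , (λ ()) , ¬p₁ , λ p₂ → contradiction (unique p₀ p₂) λ ()
... | no ¬p₀ | yes p₁ = # 0 , # 2 , (λ ()) , ¬p₀ , λ p₂ → contradiction (unique p₁ p₂) λ ()
... | no ¬p₀ | no ¬p₁ = # 0 , # 1 , (λ ()) , ¬p₀ , ¬p₁

record ThirdNeighbour {n} (A : Adj n) (c a b : Fin n) : Set where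
  field
    vertex   : Fin n
    adjacent : A c vertex ≡ true
    ≢left    : vertex ≢ a
    ≢right   : vertex ≢ b
    only     : ∀ {y} → A c y ≡ true → y ≡ a ⊎ y ≡ b ⊎ y ≡ vertex

module _ {n} {A : Adj n} {c} (N : ThreeNeighbours A c) where
  open ThreeNeighbours N

  three-neighbours⇒degree : 3 ≤ deg A c
  three-neighbours⇒degree = ≤∣tabulate∣ neighbour neighbour-injective neighbour-adjacent

  third-neighbour : ∀ {a b} → a ≢ b → A c a ≡ true → A c b ≡ true → ThirdNeighbour A c a b
  third-neighbour a≢b ca cb with neighbour-complete ca | neighbour-complete cb
  ... | i , refl | j , refl with fin3-third i j (a≢b ∘ cong neighbour)
  ...   | k , k≢i , k≢j , cover = record
    { vertex   = neighbour k
    ; adjacent = neighbour-adjacent k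
    ; ≢left    = k≢i ∘ neighbour-injective
    ; ≢right   = k≢j ∘ neighbour-injective
    ; only     = only
    }
    where
    only : ∀ {y} → A c y ≡ true → y ≡ neighbour i ⊎ y ≡ neighbour j ⊎ y ≡ neighbour k
    only cy with neighbour-complete cy
    ... | l , refl = Sum.map (cong neighbour) (Sum.map (cong neighbour) (cong neighbour)) (cover l)

  another-neighbour : ∀ a → Σ[ y ∈ Fin n ] (A c y ≡ true × y ≢ a)
  another-neighbour a with neighbour zero ≟ a
  ... | yes refl = neighbour (suc zero) , neighbour-adjacent (suc zero) , (λ ()) ∘ neighbour-injective
  ... | no ≢a    = neighbour zero , neighbour-adjacent zero , ≢a

-- The shape of an appended star of maximum degree 3: every star is a claw, attached at a non-centre.
record StarTree {n} (A : Adj n) : Set where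
  field
    tree             : RootedTree A
    centre           : Fin n → Bool
    bipartite        : ∀ {x y} → A x y ≡ true → centre y ≡ not (centre x)
    three-neighbours : ∀ {c} → centre c ≡ true → ThreeNeighbours A c
    order            : n ≡ suc (3 * ∣ tabulate centre ∣)
  open RootedTree tree public

≟-true : ∀ {n} {a b : Fin n} → ⌊ a ≟ b ⌋ ≡ true → a ≡ b
≟-true {a = a} {b} eq with a ≟ b
... | yes a≡b = a≡b

≟-refl : ∀ {n} (a : Fin n) → ⌊ a ≟ a ⌋ ≡ true
≟-refl a = trans (isYes≗does (a ≟ a)) (dec-true (a ≟ a) refl)

≟-false : ∀ {n} {a b : Fin n} → a ≢ b → ⌊ a ≟ b ⌋ ≡ false
≟-false {a = a} {b} a≢b = trans (isYes≗does (a ≟ b)) (dec-false (a ≟ b) a≢b)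

data Side (n m : ℕ) : Fin (n + m) → Set where
  old : (a : Fin n) → Side n m (a ↑ˡ m)
  new : (k : Fin m) → Side n m (n ↑ʳ k)

side : ∀ n m x → Side n m x
side zero    m x       = new x
side (suc n) m zero    = old zero
side (suc n) m (suc x) with side n m x
... | old a = old (suc a)
... | new k = new k

↑ˡ≢↑ʳ : ∀ {n m} (a : Fin n) (k : Fin m) → a ↑ˡ m ≢ n ↑ʳ k
↑ˡ≢↑ʳ {n} {m} a k eq with () ← trans (sym (splitAt-↑ˡ n a m)) (trans (cong (splitAt n) eq) (splitAt-↑ʳ n m k))

module Append {n} (A : Adj n) (v : Fin n) (Δ : ℕ) where

  A⁺ : Adj (n + suc Δ)
  A⁺ = appendAdj A v (suc Δ)

  newCentre : Fin (n + suc Δ)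
  newCentre = n ↑ʳ zero

  newLeaf : Fin Δ → Fin (n + suc Δ)
  newLeaf k = n ↑ʳ suc k

  _⁺ : Fin n → Fin (n + suc Δ)
  a ⁺ = a ↑ˡ suc Δ

  data Edge : Fin (n + suc Δ) → Fin (n + suc Δ) → Set where
    old      : ∀ {a b} → A a b ≡ true → Edge (a ⁺) (b ⁺)
    attach   : Edge (v ⁺) newCentre
    attach⁻¹ : Edge newCentre (v ⁺)
    spoke    : ∀ k → Edge newCentre (newLeaf k)
    spoke⁻¹  : ∀ k → Edge (newLeaf k) newCentre

  old-old : ∀ a b → A⁺ (a ⁺) (b ⁺) ≡ A a b
  old-old a b rewrite splitAt-↑ˡ n a (suc Δ) | splitAt-↑ˡ n b (suc Δ) = refl
  old-new : ∀ a k → A⁺ (a ⁺) (n ↑ʳ k) ≡ isCentre k ∧ ⌊ a ≟ v ⌋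
  old-new a k rewrite splitAt-↑ˡ n a (suc Δ) | splitAt-↑ʳ n (suc Δ) k = refl
  new-old : ∀ k b → A⁺ (n ↑ʳ k) (b ⁺) ≡ isCentre k ∧ ⌊ b ≟ v ⌋
  new-old k b rewrite splitAt-↑ˡ n b (suc Δ) | splitAt-↑ʳ n (suc Δ) k = refl
  new-new : ∀ k l → A⁺ (n ↑ʳ k) (n ↑ʳ l) ≡ isCentre k xor isCentre l
  new-new k l rewrite splitAt-↑ʳ n (suc Δ) k | splitAt-↑ʳ n (suc Δ) l = refl

  edge⇒adjacent : ∀ {x y} → Edge x y → A⁺ x y ≡ true
  edge⇒adjacent (old {a} {b} e) = trans (old-old a b) e
  edge⇒adjacent attach          = trans (old-new v zero) (≟-refl v)
  edge⇒adjacent attach⁻¹        = trans (new-old zero v) (≟-refl v)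
  edge⇒adjacent (spoke k)       = new-new zero (suc k)
  edge⇒adjacent (spoke⁻¹ k)     = new-new (suc k) zero

  adjacent⇒edge : ∀ {x y} → A⁺ x y ≡ true → Edge x y
  adjacent⇒edge {x} {y} e with side n (suc Δ) x | side n (suc Δ) y
  ... | old a | old b = old (trans (sym (old-old a b)) e)
  ... | old a | new zero with ≟-true {a = a} {v} (trans (sym (old-new a zero)) e)
  ...   | refl = attach
  adjacent⇒edge e | old a | new (suc k) with () ← trans (sym (old-new a (suc k))) e
  adjacent⇒edge e | new zero | old b with ≟-true {a = b} {v} (trans (sym (new-old zero b)) e)
  ...   | refl = attach⁻¹
  adjacent⇒edge e | new (suc k) | old b with () ← trans (sym (new-old (suc k) b)) e
  adjacent⇒edge e | new zero    | new zero    with () ← trans (sym (new-new zero zero)) e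
  adjacent⇒edge e | new zero    | new (suc l) = spoke l
  adjacent⇒edge e | new (suc k) | new zero    = spoke⁻¹ k
  adjacent⇒edge e | new (suc k) | new (suc l) with () ← trans (sym (new-new (suc k) (suc l))) e

  symmetric⁺ : (∀ x y → A x y ≡ A y x) → ∀ x y → A⁺ x y ≡ A⁺ y x
  symmetric⁺ sym-A x y with side n (suc Δ) x | side n (suc Δ) y
  ... | old a | old b = trans (old-old a b) (trans (sym-A a b) (sym (old-old b a)))
  ... | old a | new k = trans (old-new a k) (sym (new-old k a))
  ... | new k | old b = trans (new-old k b) (sym (old-new b k))
  ... | new k | new l = trans (new-new k l) (trans (xor-comm (isCentre k) (isCentre l)) (sym (new-new l k)))

  degree-old : ∀ a → deg A a ≤ deg A⁺ (a ⁺)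
  degree-old a = begin
    deg A a                                                ≡⟨ ∣tabulate∣-cong (sym ∘ old-old a) ⟩
    ∣ tabulate (row ∘ _⁺) ∣                                ≤⟨ m≤m+n _ _ ⟩
    ∣ tabulate (row ∘ _⁺) ∣ + ∣ tabulate (row ∘ (n ↑ʳ_)) ∣ ≡⟨ ∣tabulate∣-++ {n} row ⟨
    deg A⁺ (a ⁺)                                           ∎
    where
    open ≤-Reasoning
    row = A⁺ (a ⁺)

  degree-attach : suc (deg A v) ≤ deg A⁺ (v ⁺)
  degree-attach = begin
    suc (deg A v)                                          ≡⟨ +-comm 1 _ ⟩
    deg A v + 1                                            ≡⟨ cong (_+ 1) (∣tabulate∣-cong (sym ∘ old-old v)) ⟩
    ∣ tabulate (row ∘ _⁺) ∣ + 1                            ≤⟨ +-monoʳ-≤ _ (1≤∣tabulate∣ {f = row ∘ (n ↑ʳ_)} {zero} attached) ⟩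
    ∣ tabulate (row ∘ _⁺) ∣ + ∣ tabulate (row ∘ (n ↑ʳ_)) ∣ ≡⟨ ∣tabulate∣-++ {n} row ⟨
    deg A⁺ (v ⁺)                                           ∎
    where
    open ≤-Reasoning
    row = A⁺ (v ⁺)
    attached = edge⇒adjacent attach

  neighbour⁺ : Fin (suc Δ) → Fin (n + suc Δ)
  neighbour⁺ zero    = v ⁺
  neighbour⁺ (suc k) = newLeaf k

  neighbour⁺-injective : Injective _≡_ _≡_ neighbour⁺
  neighbour⁺-injective {zero}  {zero}  _  = refl
  neighbour⁺-injective {zero}  {suc j} eq = contradiction eq (↑ˡ≢↑ʳ v (suc j))
  neighbour⁺-injective {suc i} {zero}  eq = contradiction (sym eq) (↑ˡ≢↑ʳ v (suc i))
  neighbour⁺-injective {suc i} {suc j} eq = ↑ʳ-injective n (suc i) (suc j) eq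

  neighbour⁺-adjacent : ∀ k → A⁺ newCentre (neighbour⁺ k) ≡ true
  neighbour⁺-adjacent zero    = edge⇒adjacent attach⁻¹
  neighbour⁺-adjacent (suc k) = edge⇒adjacent (spoke k)

  degree-centre : suc Δ ≤ deg A⁺ newCentre
  degree-centre = ≤∣tabulate∣ neighbour⁺ neighbour⁺-injective neighbour⁺-adjacent

  rootedTree⁺ : RootedTree A → RootedTree A⁺
  rootedTree⁺ T = record
    { symmetric       = symmetric⁺ symmetric
    ; rank            = rank⁺
    ; root            = root ⁺
    ; parent          = parent⁺
    ; edge-rank       = edge-rank⁺ ∘ adjacent⇒edge
    ; lower-is-parent = lower-is-parent⁺ ∘ adjacent⇒edge
    ; to-parent       = to-parent⁺
    }
    where
    open RootedTree T

    newRank : Fin (suc Δ) → ℕ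
    newRank zero    = suc (rank v)
    newRank (suc _) = suc (suc (rank v))

    newParent : Fin (suc Δ) → Fin (n + suc Δ)
    newParent zero    = v ⁺
    newParent (suc _) = newCentre

    rank⁺ : Fin (n + suc Δ) → ℕ
    rank⁺ = rank ++ newRank

    parent⁺ : Fin (n + suc Δ) → Fin (n + suc Δ)
    parent⁺ = (_⁺ ∘ parent) ++ newParent

    rank-old : ∀ a → rank⁺ (a ⁺) ≡ rank a
    rank-old = lookup-++ˡ rank newRank
    rank-new : ∀ k → rank⁺ (n ↑ʳ k) ≡ newRank k
    rank-new = lookup-++ʳ rank newRank
    parent-old : ∀ a → parent⁺ (a ⁺) ≡ parent a ⁺
    parent-old = lookup-++ˡ (_⁺ ∘ parent) newParent
    parent-new : ∀ k → parent⁺ (n ↑ʳ k) ≡ newParent k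
    parent-new = lookup-++ʳ (_⁺ ∘ parent) newParent

    edge-rank⁺ : ∀ {x y} → Edge x y → rank⁺ x < rank⁺ y ⊎ rank⁺ y < rank⁺ x
    edge-rank⁺ (old {a} {b} e) rewrite rank-old a | rank-old b = edge-rank e
    edge-rank⁺ attach          rewrite rank-old v | rank-new zero = inj₁ (n<1+n _)
    edge-rank⁺ attach⁻¹        rewrite rank-old v | rank-new zero = inj₂ (n<1+n _)
    edge-rank⁺ (spoke k)       rewrite rank-new zero | rank-new (suc k) = inj₁ (n<1+n _)
    edge-rank⁺ (spoke⁻¹ k)     rewrite rank-new zero | rank-new (suc k) = inj₂ (n<1+n _)

    lower-is-parent⁺ : ∀ {x y} → Edge x y → rank⁺ y < rank⁺ x → parent⁺ x ≡ y
    lower-is-parent⁺ (old {a} {b} e) b<a rewrite rank-old a | rank-old b =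
      trans (parent-old a) (cong _⁺ (lower-is-parent e b<a))
    lower-is-parent⁺ attach b<a rewrite rank-old v | rank-new zero = contradiction b<a (<-asym (n<1+n _))
    lower-is-parent⁺ attach⁻¹ _ = parent-new zero
    lower-is-parent⁺ (spoke k) b<a rewrite rank-new zero | rank-new (suc k) = contradiction b<a (<-asym (n<1+n _))
    lower-is-parent⁺ (spoke⁻¹ k) _ = parent-new (suc k)

    to-parent⁺ : ∀ x → x ≡ root ⁺ ⊎ (A⁺ x (parent⁺ x) ≡ true × rank⁺ (parent⁺ x) < rank⁺ x)
    to-parent⁺ x with side n (suc Δ) x
    ... | new zero    rewrite parent-new zero | rank-old v | rank-new zero =
      inj₂ (edge⇒adjacent attach⁻¹ , n<1+n _)
    ... | new (suc k) rewrite parent-new (suc k) | rank-new zero | rank-new (suc k) =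
      inj₂ (edge⇒adjacent (spoke⁻¹ k) , n<1+n _)
    ... | old a with to-parent a
    ...   | inj₁ refl = inj₁ refl
    ...   | inj₂ (e , p<a) rewrite parent-old a | rank-old a | rank-old (parent a) =
      inj₂ (edge⇒adjacent (old e) , p<a)

∧-trueʳ : ∀ {a b} → a ∧ b ≡ true → b ≡ true
∧-trueʳ {true} b≡true = b≡true

append-StarTree : ∀ {n} {A : Adj n} (S : StarTree A) v → StarTree.centre S v ≡ false →
                  StarTree (appendAdj A v 3)
append-StarTree {n} {A} S v v-non-centre = record
  { tree             = rootedTree⁺ tree
  ; centre           = centre⁺
  ; bipartite        = bipartite⁺ ∘ adjacent⇒edge
  ; three-neighbours = three-neighbours⁺ _
  ; order            = order⁺
  }
  where
  open StarTree S
  open Append A v 2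

  centre⁺ : Fin (n + 3) → Bool
  centre⁺ = centre ++ isCentre

  centre-old : ∀ a → centre⁺ (a ⁺) ≡ centre a
  centre-old = lookup-++ˡ centre isCentre
  centre-new : ∀ k → centre⁺ (n ↑ʳ k) ≡ isCentre k
  centre-new = lookup-++ʳ centre isCentre

  bipartite⁺ : ∀ {x y} → Edge x y → centre⁺ y ≡ not (centre⁺ x)
  bipartite⁺ (old {a} {b} e) rewrite centre-old a | centre-old b = bipartite e
  bipartite⁺ attach          rewrite centre-old v | centre-new zero | v-non-centre = refl
  bipartite⁺ attach⁻¹        rewrite centre-old v | centre-new zero | v-non-centre = refl
  bipartite⁺ (spoke k)       rewrite centre-new zero | centre-new (suc k) = refl
  bipartite⁺ (spoke⁻¹ k)     rewrite centre-new zero | centre-new (suc k) = refl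

  old-three-neighbours : ∀ {a} → centre a ≡ true → ThreeNeighbours A⁺ (a ⁺)
  old-three-neighbours {a} a-centre = record
    { neighbour           = _⁺ ∘ neighbour
    ; neighbour-injective = neighbour-injective ∘ ↑ˡ-injective 3 _ _
    ; neighbour-adjacent  = λ i → edge⇒adjacent (Edge.old (neighbour-adjacent i))
    ; neighbour-complete  = complete
    }
    where
    open ThreeNeighbours (three-neighbours a-centre)
    complete : ∀ {y} → A⁺ (a ⁺) y ≡ true → ∃[ i ] (neighbour i ⁺ ≡ y)
    complete {y} e with side n 3 y
    ... | old b with neighbour-complete (trans (sym (old-old a b)) e)
    ...   | i , refl = i , refl
    complete e | new k with ≟-true {a = a} {v} (∧-trueʳ {isCentre k} (trans (sym (old-new a k)) e))
    ...   | refl = contradiction (trans (sym a-centre) v-non-centre) λ ()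

  new-three-neighbours : ThreeNeighbours A⁺ newCentre
  new-three-neighbours = record
    { neighbour           = neighbour⁺
    ; neighbour-injective = neighbour⁺-injective
    ; neighbour-adjacent  = neighbour⁺-adjacent
    ; neighbour-complete  = complete
    }
    where
    complete : ∀ {y} → A⁺ newCentre y ≡ true → ∃[ i ] (neighbour⁺ i ≡ y)
    complete {y} e with side n 3 y
    ... | old b with ≟-true {a = b} {v} (trans (sym (new-old zero b)) e)
    ...   | refl = zero , refl
    complete e | new zero with () ← trans (sym (new-new zero zero)) e
    complete e | new (suc l) = suc l , refl

  three-neighbours⁺ : ∀ c → centre⁺ c ≡ true → ThreeNeighbours A⁺ c
  three-neighbours⁺ c c-centre with side n 3 c
  ... | old a       = old-three-neighbours (trans (sym (centre-old a)) c-centre)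
  ... | new zero    = new-three-neighbours
  ... | new (suc k) with () ← trans (sym (centre-new (suc k))) c-centre

  order⁺ : n + 3 ≡ suc (3 * ∣ tabulate centre⁺ ∣)
  order⁺ = begin
    n + 3                                    ≡⟨ cong (_+ 3) order ⟩
    suc (3 * ∣ tabulate centre ∣ + 3 * 1)    ≡⟨ cong suc (*-distribˡ-+ 3 ∣ tabulate centre ∣ 1) ⟨
    suc (3 * (∣ tabulate centre ∣ + 1))      ≡⟨ cong (λ k → suc (3 * k)) count ⟨
    suc (3 * ∣ tabulate centre⁺ ∣)           ∎
    where
    open ≡-Reasoning
    count : ∣ tabulate centre⁺ ∣ ≡ ∣ tabulate centre ∣ + 1
    count = trans (∣tabulate∣-++ {n} {3} centre⁺)
                  (cong₂ _+_ (∣tabulate∣-cong centre-old) (∣tabulate∣-cong centre-new))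

star-degree : ∀ Δ → deg (starAdj Δ) zero ≡ Δ
star-degree = ∣tabulate-true∣

star-RootedTree : ∀ Δ → RootedTree (starAdj Δ)
star-RootedTree Δ = record
  { symmetric       = symmetric
  ; rank            = λ { zero → 0 ; (suc _) → 1 }
  ; root            = zero
  ; parent          = λ _ → zero
  ; edge-rank       = edge-rank
  ; lower-is-parent = lower-is-parent
  ; to-parent       = λ { zero → inj₁ refl ; (suc _) → inj₂ (refl , s≤s z≤n) }
  }
  where
  symmetric : ∀ x y → starAdj Δ x y ≡ starAdj Δ y x
  symmetric zero    zero    = refl
  symmetric zero    (suc _) = refl
  symmetric (suc _) zero    = refl
  symmetric (suc _) (suc _) = refl
  edge-rank : ∀ {x y} → starAdj Δ x y ≡ true → _
  edge-rank {zero}  {suc _} _ = inj₁ (s≤s z≤n)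
  edge-rank {suc _} {zero}  _ = inj₂ (s≤s z≤n)
  lower-is-parent : ∀ {x y} → starAdj Δ x y ≡ true → _ → zero ≡ y
  lower-is-parent {suc _} {zero} _ _ = refl
  lower-is-parent {zero} {suc _} _ ()

star-StarTree : StarTree (starAdj 3)
star-StarTree = record
  { tree             = star-RootedTree 3
  ; centre           = isCentre
  ; bipartite        = bipartite
  ; three-neighbours = λ { {zero} _ → record
      { neighbour           = suc
      ; neighbour-injective = suc-injective
      ; neighbour-adjacent  = λ _ → refl
      ; neighbour-complete  = λ { {suc i} _ → i , refl }
      } }
  ; order            = refl
  }
  where
  bipartite : ∀ {x y} → starAdj 3 x y ≡ true → isCentre y ≡ not (isCentre x)
  bipartite {zero}  {suc _} _ = refl
  bipartite {suc _} {zero}  _ = refl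

constructed⇒StarTree : ∀ {p n A} → ConstructedAS p n A → (∀ x → deg A x ≤ 3) → StarTree A
constructed⇒StarTree (base Δ 3≤Δ) deg≤3 with ≤-antisym (subst (_≤ 3) (star-degree Δ) (deg≤3 zero)) 3≤Δ
... | refl = star-StarTree
constructed⇒StarTree (step c v zero ()) _
constructed⇒StarTree (step {A = A} c v (suc Δ) 3≤Δ) deg≤3
  with ≤-antisym (≤-trans (Append.degree-centre A v Δ) (deg≤3 (Append.newCentre A v Δ))) 3≤Δ
... | refl = append-StarTree S v v-non-centre
  where
  open Append A v 2
  S = constructed⇒StarTree c (λ a → ≤-trans (degree-old a) (deg≤3 (a ⁺)))
  v-non-centre : StarTree.centre S v ≡ false
  v-non-centre with StarTree.centre S v in v-centre
  ... | false = refl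
  ... | true  = contradiction (≤-trans (s≤s (three-neighbours⇒degree (StarTree.three-neighbours S v-centre)))
                                        (≤-trans degree-attach (deg≤3 (v ⁺)))) 1+n≰n

module Transport {n} {A A′ : Adj n} (σ : Fin n ↔ Fin n)
                 (iso : ∀ u w → A u w ≡ A′ (Inverse.to σ u) (Inverse.to σ w)) where
  open Inverse σ

  adjacent-from : ∀ x y → A x (from y) ≡ A′ (to x) y
  adjacent-from x y = trans (iso x (from y)) (cong (A′ (to x)) (strictlyInverseˡ y))

  adjacent-to : ∀ x y → A (from x) y ≡ A′ x (to y)
  adjacent-to x y = trans (iso (from x) y) (cong (λ x′ → A′ x′ (to y)) (strictlyInverseˡ x))

  degree : ∀ x → deg A′ x ≡ deg A (from x)
  degree x = begin
    ∣ tabulate (A′ x) ∣              ≡⟨ ∣tabulate∣-permute σ (A′ x) ⟨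
    ∣ tabulate (A′ x ∘ to) ∣         ≡⟨ ∣tabulate∣-cong (λ w → sym (adjacent-to x w)) ⟩
    ∣ tabulate (A (from x)) ∣        ∎
    where open ≡-Reasoning

  rootedTree : RootedTree A′ → RootedTree A
  rootedTree T = record
    { symmetric       = λ x y → trans (iso x y) (trans (symmetric (to x) (to y)) (sym (iso y x)))
    ; rank            = rank ∘ to
    ; root            = from root
    ; parent          = from ∘ parent ∘ to
    ; edge-rank       = λ {x} {y} e → edge-rank (trans (sym (iso x y)) e)
    ; lower-is-parent = λ {x} {y} e y<x →
        trans (cong from (lower-is-parent (trans (sym (iso x y)) e) y<x)) (strictlyInverseʳ y)
    ; to-parent       = to-parent′
    }
    where
    open RootedTree T
    to-parent′ : ∀ x → x ≡ from root ⊎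
                       (A x (from (parent (to x))) ≡ true × rank (to (from (parent (to x)))) < rank (to x))
    to-parent′ x with to-parent (to x)
    ... | inj₁ eq        = inj₁ (trans (sym (strictlyInverseʳ x)) (cong from eq))
    ... | inj₂ (e , p<x) = inj₂ (trans (adjacent-from x _) e , subst (λ p → rank p < rank (to x)) (sym (strictlyInverseˡ _)) p<x)

  starTree : StarTree A′ → StarTree A
  starTree S = record
    { tree             = rootedTree tree
    ; centre           = centre ∘ to
    ; bipartite        = λ {x} {y} e → bipartite (trans (sym (iso x y)) e)
    ; three-neighbours = three-neighbours′
    ; order            = trans order (cong (λ k → suc (3 * k)) (sym (∣tabulate∣-permute σ centre)))
    }
    where
    open StarTree S
    three-neighbours′ : ∀ {c} → centre (to c) ≡ true → ThreeNeighbours A c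
    three-neighbours′ {c} c-centre = record
      { neighbour           = from ∘ neighbour
      ; neighbour-injective = neighbour-injective ∘ Injection.injective (↔⇒↣ (↔-sym σ))
      ; neighbour-adjacent  = λ i → trans (adjacent-from c (neighbour i)) (neighbour-adjacent i)
      ; neighbour-complete  = complete
      }
      where
      open ThreeNeighbours (three-neighbours c-centre)
      complete : ∀ {y} → A c y ≡ true → ∃[ i ] (from (neighbour i) ≡ y)
      complete {y} e with neighbour-complete (trans (sym (iso c y)) e)
      ... | i , eq = i , trans (cong from eq) (strictlyInverseʳ y)

appendedStar⇒StarTree : ∀ {n A} → IsAppendedStar n A → (∀ x → deg A x ≤ 3) → StarTree A
appendedStar⇒StarTree (_ , _ , A′ , constructed , σ , iso) deg≤3 =
  starTree (constructed⇒StarTree constructed (λ x → subst (_≤ 3) (sym (degree x)) (deg≤3 _)))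
  where open Transport {A′ = A′} σ iso

-- The caterpillar pattern

odd : ℕ → Bool
odd zero    = false
odd (suc n) = not (odd n)

odd-double : ∀ m → odd (2 * m) ≡ false
odd-double zero    = refl
odd-double (suc m) = trans (cong odd (*-suc 2 m)) (trans (not-involutive (odd (2 * m))) (odd-double m))

-- The pattern is a caterpillar on Fin 13: splitAt 9 sends the spine vertices to inj₁ a (a = 0, …, 8)
-- and the pendants to inj₂ k, pendant k hanging from spine vertex 2k + 1.
Part : Set
Part = Fin 9 ⊎ Fin 4

partCentre : Part → Bool
partCentre (inj₁ a) = odd (toℕ a)
partCentre (inj₂ _) = false

partAdj : Part → Part → Bool
partAdj (inj₁ a) (inj₁ b) = ⌊ (toℕ b ℕ.≟ suc (toℕ a)) ⊎-dec (toℕ a ℕ.≟ suc (toℕ b)) ⌋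
partAdj (inj₁ a) (inj₂ k) = ⌊ toℕ a ℕ.≟ suc (2 * toℕ k) ⌋
partAdj (inj₂ k) (inj₁ b) = ⌊ toℕ b ℕ.≟ suc (2 * toℕ k) ⌋
partAdj (inj₂ _) (inj₂ _) = false

partCode : Part → Bool
partCode (inj₁ a) = not ⌊ a ≟ # 4 ⌋
partCode (inj₂ _) = false

patternCentre : Fin 13 → Bool
patternCentre = partCentre ∘ splitAt 9

patternAdj : Fin 13 → Fin 13 → Bool
patternAdj i j = partAdj (splitAt 9 i) (splitAt 9 j)

patternCode : Fin 13 → Bool
patternCode = partCode ∘ splitAt 9

patternTrace : Fin 13 → Fin 13 → Bool
patternTrace i j = (⌊ j ≟ i ⌋ ∨ patternAdj i j) ∧ patternCode j

-- exchanges spine vertex 2k + 1 with pendant k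
swap : Fin 13 → Fin 13
swap = lookup (# 0 ∷ # 9 ∷ # 2 ∷ # 10 ∷ # 4 ∷ # 11 ∷ # 6 ∷ # 12 ∷ # 8 ∷ # 1 ∷ # 3 ∷ # 5 ∷ # 7 ∷ [])

-- decided by evaluation, and opaque so that using them never unfolds the decision procedures
opaque
  pattern-dominating : ∀ i → ∃[ j ] patternTrace i j ≡ true
  pattern-dominating = from-yes (all? λ (i : Fin 13) → any? λ (j : Fin 13) → patternTrace i j Bool.≟ true)

  pattern-separating : ∀ i i′ → i ≢ i′ → ∃[ j ] patternTrace i j ≢ patternTrace i′ j
  pattern-separating = from-yes (all? λ (i : Fin 13) → all? λ (i′ : Fin 13) → ¬? (i ≟ i′) →-dec
                         any? λ (j : Fin 13) → ¬? (patternTrace i j Bool.≟ patternTrace i′ j))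

  swap-injective : Injective _≡_ _≡_ swap
  swap-injective {i} {j} = from-yes (all? λ (i : Fin 13) → all? λ (j : Fin 13) → (swap i ≟ swap j) →-dec (i ≟ j)) i j

  swap-code : ∀ i → patternCode i ≡ true → patternCentre (swap i) ≡ false × swap i ≢ # 4
  swap-code = from-yes (all? λ (i : Fin 13) → (patternCode i Bool.≟ true) →-dec
                          ((patternCentre (swap i) Bool.≟ false) ×-dec ¬? (swap i ≟ # 4)))

  odd-spine : ∀ (a : Fin 9) → odd (toℕ a) ≡ true → ∃[ k ] toℕ a ≡ suc (2 * toℕ {4} k)
  odd-spine = from-yes (all? λ (a : Fin 9) → (odd (toℕ a) Bool.≟ true) →-dec
                          any? λ (k : Fin 4) → toℕ a ℕ.≟ suc (2 * toℕ k))

-- A spine with pendants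

module StarTreeProperties {n} {A : Adj n} (S : StarTree A) where
  open StarTree S public
  open RootedTreeProperties tree public

  record PatternEmbedding : Set where
    field
      h               : Fin 13 → Fin n
      h-injective     : Injective _≡_ _≡_ h
      h-centre        : ∀ i → centre (h i) ≡ patternCentre i
      h-adjacent      : ∀ i j → A (h i) (h j) ≡ patternAdj i j
      h-closed        : ∀ i {y} → patternCentre i ≡ true → A (h i) y ≡ true → ∃[ j ] h j ≡ y
      h-attached-once : ∀ {x} → (∀ j → h j ≢ x) → ∀ {i j} → A x (h i) ≡ true → A x (h j) ≡ true → i ≡ j

  record Spine : Set where
    field
      vertex            : ℕ → Fin n
      walk              : IsWalk A vertex 8
      non-backtracking  : NonBacktracking A vertex 8
      starts-off-centre : centre (vertex 0) ≡ false

  -- A geodesic of length at least 8; if it starts at a centre, prepend another neighbour of it.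
  spine : DiameterAtLeast A 8 → Spine
  spine (u , v , no-short-walk) with connected u v
  ... | _ , w with distance A w
  ... | d , dist with ¬walk⇒<distance A no-short-walk dist | centre u in u-centre
  ...   | 8≤d | false = record
    { vertex            = geodesic A d dist
    ; walk              = λ t t<8 → geodesic-walk A d dist t (<-≤-trans t<8 8≤d)
    ; non-backtracking  = λ t 2+t≤8 → geodesic-non-backtracking A d dist t (≤-trans 2+t≤8 8≤d)
    ; starts-off-centre = u-centre
    }
  ...   | 8≤d | true = record
    { vertex            = vertex
    ; walk              = walk′
    ; non-backtracking  = non-backtracking′
    ; starts-off-centre = trans (bipartite uy) (cong not u-centre)
    }
    where
    g = geodesic A d dist
    other = another-neighbour (three-neighbours u-centre) (g 1)
    y = proj₁ other
    uy = proj₁ (proj₂ other)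
    vertex : ℕ → Fin n
    vertex zero    = y
    vertex (suc t) = g t
    walk′ : IsWalk A vertex 8
    walk′ zero    _         = trans (symmetric _ _) uy
    walk′ (suc t) (s≤s t<7) = geodesic-walk A d dist t (≤-trans (m≤n⇒m≤1+n t<7) 8≤d)
    non-backtracking′ : NonBacktracking A vertex 8
    non-backtracking′ zero    _           = proj₂ (proj₂ other)
    non-backtracking′ (suc t) (s≤s 2+t≤7) = geodesic-non-backtracking A d dist t (≤-trans (m≤n⇒m≤1+n 2+t≤7) 8≤d)

  module SpineProperties (P : Spine) where
    open Spine P renaming (vertex to s)

    spine-injective : ∀ {i j} → i < j → j ≤ 8 → s i ≢ s j
    spine-injective = non-backtracking-injective walk non-backtracking

    spine-chordless : ∀ {i j} → i < j → j ≤ 8 → A (s i) (s j) ≡ true → j ≡ suc i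
    spine-chordless = non-backtracking-chordless walk non-backtracking

    spine-parity : ∀ t → t ≤ 8 → centre (s t) ≡ odd t
    spine-parity zero    _   = starts-off-centre
    spine-parity (suc t) t<8 = trans (bipartite (walk t t<8)) (cong not (spine-parity t (<⇒≤ t<8)))

    spine-segment : ∀ {Q : Fin n → Set} {i j} → i ≤ j → j ≤ 8 → (∀ t → t ≤ 8 → Q (s t)) →
                    WalkWithin A Q (s i) (s j)
    spine-segment {Q} {i} {j} i≤j j≤8 q = subst (WalkWithin A Q (s i) ∘ s) (m∸n+n≡m i≤j)
      (walkWithin-seq A (j ∸ i) (isWalk-shift A i j∸i+i≤8 walk) (λ t t≤j∸i → q (t + i) (t+i≤8 t≤j∸i)))
      where
      j∸i+i≤8 = ≤-trans (≤-reflexive (m∸n+n≡m i≤j)) j≤8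
      t+i≤8 : ∀ {t} → t ≤ j ∸ i → t + i ≤ 8
      t+i≤8 t≤j∸i = ≤-trans (+-monoˡ-≤ i t≤j∸i) j∸i+i≤8

    spine-walk : ∀ {Q : Fin n → Set} i j → i ≤ 8 → j ≤ 8 → (∀ t → t ≤ 8 → Q (s t)) →
                 WalkWithin A Q (s i) (s j)
    spine-walk i j i≤8 j≤8 q with ≤-total i j
    ... | inj₁ i≤j = spine-segment i≤j j≤8 q
    ... | inj₂ j≤i = walkWithin-reverse A symmetric (spine-segment j≤i i≤8 q)

    spine-≢ : ∀ {i j} → i ≢ j → i ≤ 8 → j ≤ 8 → s i ≢ s j
    spine-≢ {i} {j} i≢j i≤8 j≤8 with <-cmp i j
    ... | tri< i<j _ _ = spine-injective i<j j≤8
    ... | tri≈ _ i≡j _ = contradiction i≡j i≢j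
    ... | tri> _ _ j<i = spine-injective j<i i≤8 ∘ sym

    spine-adjacent : ∀ {i j} → i ≤ 8 → j ≤ 8 → A (s i) (s j) ≡ true → j ≡ suc i ⊎ i ≡ suc j
    spine-adjacent {i} {j} i≤8 j≤8 e with <-cmp i j
    ... | tri< i<j _ _  = inj₁ (spine-chordless i<j j≤8 e)
    ... | tri≈ _ refl _ = contradiction refl (adjacent⇒≢ e)
    ... | tri> _ _ j<i  = inj₂ (spine-chordless j<i i≤8 (trans (symmetric _ _) e))

    spine-adjacent⁻¹ : ∀ {i j} → i ≤ 8 → j ≤ 8 → j ≡ suc i ⊎ i ≡ suc j → A (s i) (s j) ≡ true
    spine-adjacent⁻¹ _   j≤8 (inj₁ refl) = walk _ j≤8
    spine-adjacent⁻¹ i≤8 _   (inj₂ refl) = trans (symmetric _ _) (walk _ i≤8)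

    2+2k≤8 : ∀ (k : Fin 4) → 2 + 2 * toℕ k ≤ 8
    2+2k≤8 k = +-monoʳ-≤ 2 (*-monoʳ-≤ 2 (≤-pred (toℕ<n k)))

    1+2k≤8 : ∀ (k : Fin 4) → suc (2 * toℕ k) ≤ 8
    1+2k≤8 k = ≤-trans (n≤1+n _) (2+2k≤8 k)

    third : ∀ (k : Fin 4) → ThirdNeighbour A (s (suc (2 * toℕ k))) (s (2 * toℕ k)) (s (2 + 2 * toℕ k))
    third k = third-neighbour (three-neighbours is-centre) (non-backtracking (2 * toℕ k) (2+2k≤8 k))
                (trans (symmetric _ _) (walk _ (1+2k≤8 k))) (walk _ (2+2k≤8 k))
      where
      is-centre : centre (s (suc (2 * toℕ k))) ≡ true
      is-centre = trans (spine-parity _ (1+2k≤8 k)) (cong not (odd-double (toℕ k)))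

    pendant : Fin 4 → Fin n
    pendant k = ThirdNeighbour.vertex (third k)

    pendant-adjacent : ∀ k {t} → t ≡ suc (2 * toℕ k) → A (s t) (pendant k) ≡ true
    pendant-adjacent k refl = ThirdNeighbour.adjacent (third k)

    pendant-non-centre : ∀ k → centre (pendant k) ≡ false
    pendant-non-centre k = trans (bipartite (pendant-adjacent k refl))
                             (cong not (trans (spine-parity _ (1+2k≤8 k)) (cong not (odd-double (toℕ k)))))

    pendant-off-spine : ∀ k t → t ≤ 8 → pendant k ≢ s t
    pendant-off-spine k t t≤8 pₖ≡sₜ
      with spine-adjacent (1+2k≤8 k) t≤8 (subst (λ y → A _ y ≡ true) pₖ≡sₜ (pendant-adjacent k refl))
    ... | inj₁ t≡2+2k   = ThirdNeighbour.≢right (third k) (trans pₖ≡sₜ (cong s t≡2+2k))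
    ... | inj₂ 1+2k≡1+t = ThirdNeighbour.≢left (third k) (trans pₖ≡sₜ (cong s (sym (ℕₚ.suc-injective 1+2k≡1+t))))

    -- a second spine neighbour of pendant k would make a detour around it along the spine
    pendant-anchor : ∀ k {t} → t ≤ 8 → A (s t) (pendant k) ≡ true → t ≡ suc (2 * toℕ k)
    pendant-anchor k {t} t≤8 e with t ℕ.≟ suc (2 * toℕ k)
    ... | yes t≡p = t≡p
    ... | no  t≢p = contradiction (spine-walk _ t (1+2k≤8 k) t≤8 (λ t′ t′≤8 → pendant-off-spine k t′ t′≤8 ∘ sym))
                      (no-detour (spine-≢ (t≢p ∘ sym) (1+2k≤8 k) t≤8)
                                 (trans (symmetric _ _) (pendant-adjacent k refl)) (trans (symmetric _ _) e))

    pendant-injective : Injective _≡_ _≡_ pendant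
    pendant-injective {k} {l} eq = sym (toℕ-injective (*-cancelˡ-≡ _ _ 2 (ℕₚ.suc-injective
      (pendant-anchor k (1+2k≤8 l) (subst (λ y → A _ y ≡ true) (sym eq) (pendant-adjacent l refl))))))

    toℕ≤8 : ∀ (a : Fin 9) → toℕ a ≤ 8
    toℕ≤8 a = ≤-pred (toℕ<n a)

    part : Part → Fin n
    part (inj₁ a) = s (toℕ a)
    part (inj₂ k) = pendant k

    h : Fin 13 → Fin n
    h = part ∘ splitAt 9

    part-injective : Injective _≡_ _≡_ part
    part-injective {inj₁ a} {inj₁ b} eq with toℕ a ℕ.≟ toℕ b
    ... | yes a≡b = cong inj₁ (toℕ-injective a≡b)
    ... | no  a≢b = contradiction eq (spine-≢ a≢b (toℕ≤8 a) (toℕ≤8 b))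
    part-injective {inj₁ a} {inj₂ k} eq = contradiction (sym eq) (pendant-off-spine k _ (toℕ≤8 a))
    part-injective {inj₂ k} {inj₁ b} eq = contradiction eq (pendant-off-spine k _ (toℕ≤8 b))
    part-injective {inj₂ k} {inj₂ l} eq = cong inj₂ (pendant-injective eq)

    h-injective : Injective _≡_ _≡_ h
    h-injective {i} {j} eq =
      trans (sym (join-splitAt 9 4 i)) (trans (cong (join 9 4) (part-injective {splitAt 9 i} {splitAt 9 j} eq)) (join-splitAt 9 4 j))

    part-centre : ∀ u → centre (part u) ≡ partCentre u
    part-centre (inj₁ a) = spine-parity _ (toℕ≤8 a)
    part-centre (inj₂ k) = pendant-non-centre k

    ⌊⌋-⇔ : ∀ {b : Bool} {Q : Set} (Q? : Dec Q) → (b ≡ true → Q) → (Q → b ≡ true) → b ≡ ⌊ Q? ⌋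
    ⌊⌋-⇔ {true}  (yes _) _  _    = refl
    ⌊⌋-⇔ {true}  (no ¬q) to _    = contradiction (to refl) ¬q
    ⌊⌋-⇔ {false} (yes q) _  from = from q
    ⌊⌋-⇔ {false} (no _)  _  _    = refl

    part-adjacent : ∀ u v → A (part u) (part v) ≡ partAdj u v
    part-adjacent (inj₁ a) (inj₁ b) =
      ⌊⌋-⇔ _ (spine-adjacent (toℕ≤8 a) (toℕ≤8 b)) (spine-adjacent⁻¹ (toℕ≤8 a) (toℕ≤8 b))
    part-adjacent (inj₁ a) (inj₂ k) = ⌊⌋-⇔ _ (pendant-anchor k (toℕ≤8 a)) (pendant-adjacent k)
    part-adjacent (inj₂ k) (inj₁ b) = trans (symmetric _ _) (⌊⌋-⇔ _ (pendant-anchor k (toℕ≤8 b)) (pendant-adjacent k))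
    part-adjacent (inj₂ k) (inj₂ l) with A (pendant k) (pendant l) in e
    ... | false = refl
    ... | true  = contradiction (trans (sym (pendant-non-centre l)) (trans (bipartite e) (cong not (pendant-non-centre k)))) λ ()

    InImage : Fin n → Set
    InImage y = ∃[ j ] h j ≡ y

    part-in-image : ∀ u → InImage (part u)
    part-in-image u = join 9 4 u , cong part (splitAt-join 9 4 u)

    spine-in-image : ∀ t → t ≤ 8 → InImage (s t)
    spine-in-image t t≤8 = subst InImage (cong s (toℕ-fromℕ< (s≤s t≤8))) (part-in-image (inj₁ (fromℕ< (s≤s t≤8))))

    part-closed : ∀ u {y} → partCentre u ≡ true → A (part u) y ≡ true → InImage y
    part-closed (inj₁ a) a-odd e with odd-spine a a-odd
    ... | k , a≡1+2k with ThirdNeighbour.only (third k) (subst (λ t → A (s t) _ ≡ true) a≡1+2k e)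
    ...   | inj₁ refl        = spine-in-image _ (≤-trans (n≤1+n _) (1+2k≤8 k))
    ...   | inj₂ (inj₁ refl) = spine-in-image _ (2+2k≤8 k)
    ...   | inj₂ (inj₂ refl) = part-in-image (inj₂ k)

    walk-from-start : ∀ u → WalkWithin A InImage (s 0) (part u)
    walk-from-start (inj₁ a) = spine-walk 0 (toℕ a) z≤n (toℕ≤8 a) spine-in-image
    walk-from-start (inj₂ k) = walkWithin-++ A (spine-walk 0 _ z≤n (1+2k≤8 k) spine-in-image)
      (hop (spine-in-image _ (1+2k≤8 k)) (pendant-adjacent k refl) (stop (part-in-image (inj₂ k))))

    -- a vertex outside the pattern with two neighbours in it would make a detour through the pattern
    h-attached-once : ∀ {x} → (∀ j → h j ≢ x) → ∀ {i j} → A x (h i) ≡ true → A x (h j) ≡ true → i ≡ j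
    h-attached-once {x} x∉h {i} {j} xi xj with i ≟ j
    ... | yes i≡j = i≡j
    ... | no  i≢j = contradiction (walkWithin-map A avoids detour) (no-detour (i≢j ∘ h-injective) xi xj)
      where
      detour = walkWithin-++ A (walkWithin-reverse A symmetric (walk-from-start (splitAt 9 i))) (walk-from-start (splitAt 9 j))
      avoids : ∀ {y} → InImage y → y ≢ x
      avoids (l , refl) = x∉h l

    embedding : PatternEmbedding
    embedding = record
      { h               = h
      ; h-injective     = h-injective
      ; h-centre        = part-centre ∘ splitAt 9
      ; h-adjacent      = λ i j → part-adjacent (splitAt 9 i) (splitAt 9 j)
      ; h-closed        = λ i → part-closed (splitAt 9 i)
      ; h-attached-once = h-attached-once
      }

-- The identifying code

module IdentifyingCode {n} {A : Adj n} (S : StarTree A) (E : StarTreeProperties.PatternEmbedding S) where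
  open StarTreeProperties S
  open PatternEmbedding E

  Outside : Fin n → Set
  Outside x = ∀ i → h i ≢ x

  image? : ∀ x → Dec (∃[ i ] h i ≡ x)
  image? x = any? λ i → h i ≟ x

  inCode : Fin n → Bool
  inCode x with image? x
  ... | yes (i , _) = patternCode i
  ... | no  _       = not (centre x)

  code : Subset n
  code = tabulate inCode

  inCode-h : ∀ i → inCode (h i) ≡ patternCode i
  inCode-h i with image? (h i)
  ... | yes (j , hj≡hi) = cong patternCode (h-injective hj≡hi)
  ... | no  ∉image      = contradiction (i , refl) ∉image

  inCode-outside : ∀ {x} → Outside x → inCode x ≡ not (centre x)
  inCode-outside {x} out with image? x
  ... | yes (i , hi≡x) = contradiction hi≡x (out i)
  ... | no  _          = refl

  trace : Fin n → Fin n → Bool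
  trace y x = (⌊ x ≟ y ⌋ ∨ A y x) ∧ inCode x

  trace-h : ∀ i j → trace (h i) (h j) ≡ patternTrace i j
  trace-h i j = cong₂ _∧_ (cong₂ _∨_ same-test (h-adjacent i j)) (inCode-h j)
    where
    same-test : ⌊ h j ≟ h i ⌋ ≡ ⌊ j ≟ i ⌋
    same-test with h j ≟ h i | j ≟ i
    ... | yes _      | yes _    = refl
    ... | no  _      | no  _    = refl
    ... | yes hj≡hi | no  j≢i  = contradiction (h-injective hj≡hi) j≢i
    ... | no  hj≢hi | yes refl = contradiction refl hj≢hi

  centre-beside-outside : ∀ {x y} → Outside y → A y x ≡ true → centre x ≡ true → Outside x
  centre-beside-outside out e x-centre i refl
    with h-closed i (trans (sym (h-centre i)) x-centre) (trans (symmetric _ _) e)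
  ... | j , hj≡y = out j hj≡y

  -- the pattern centres keep all their neighbours, so an outside neighbour of h i is a centre
  trace-h-outside : ∀ i {x} → Outside x → trace (h i) x ≡ false
  trace-h-outside i {x} out with A (h i) x in e
  ... | false rewrite ≟-false (λ x≡hi → out i (sym x≡hi)) = refl
  ... | true  rewrite ≟-false (λ x≡hi → out i (sym x≡hi)) = not-in-code
    where
    h-non-centre : centre (h i) ≡ false
    h-non-centre with centre (h i) in hi-centre
    ... | false = refl
    ... | true  = contradiction (h-closed i (trans (sym (h-centre i)) hi-centre) e) λ (j , hj≡x) → out j hj≡x
    not-in-code : inCode x ≡ false
    not-in-code = trans (inCode-outside out) (cong not (trans (bipartite e) (cong not h-non-centre)))

  trace-self : ∀ {y} → Outside y → centre y ≡ false → trace y y ≡ true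
  trace-self {y} out y-non-centre rewrite ≟-refl y | inCode-outside out | y-non-centre = refl

  trace-non-centre : ∀ {y x} → Outside y → centre y ≡ false → x ≢ y → trace y x ≡ false
  trace-non-centre {y} {x} out y-non-centre x≢y rewrite ≟-false x≢y with A y x in e
  ... | false = refl
  ... | true  = trans (inCode-outside (centre-beside-outside out e x-centre)) (cong not x-centre)
    where
    x-centre : centre x ≡ true
    x-centre = trans (bipartite e) (cong not y-non-centre)

  trace-outer-centre : ∀ {y x} → Outside y → centre y ≡ true → trace y x ≡ true → A y x ≡ true
  trace-outer-centre {y} {x} out y-centre t with x ≟ y | A y x | inCode x in x-code
  ... | _        | true  | _     = refl
  ... | no _     | false | _     with () ← t
  ... | yes refl | false | false with () ← t
  ... | yes refl | false | true  = contradiction (trans (sym x-code) (trans (inCode-outside out) (cong not y-centre))) λ ()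

  record OuterNeighbours (y : Fin n) : Set where
    field
      first second         : Fin n
      distinct             : first ≢ second
      first-adjacent       : A y first ≡ true
      second-adjacent      : A y second ≡ true
      first-outside        : Outside first
      second-outside       : Outside second

  outer-neighbours : ∀ {y} → Outside y → centre y ≡ true → OuterNeighbours y
  outer-neighbours {y} out y-centre with fin3-two-outside (λ i → image? (neighbour i)) unique
    where
    open ThreeNeighbours (three-neighbours y-centre)
    adjacent : ∀ {a i} → h a ≡ neighbour i → A y (h a) ≡ true
    adjacent {i = i} ha≡ = subst (λ w → A y w ≡ true) (sym ha≡) (neighbour-adjacent i)
    unique : ∀ {i j} → ∃[ a ] h a ≡ neighbour i → ∃[ b ] h b ≡ neighbour j → i ≡ j
    unique (a , ha≡) (b , hb≡) =
      neighbour-injective (trans (sym ha≡) (trans (cong h (h-attached-once out (adjacent ha≡) (adjacent hb≡))) hb≡))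
  ... | i , j , i≢j , ∉i , ∉j = record
    { first           = neighbour i
    ; second          = neighbour j
    ; distinct        = i≢j ∘ neighbour-injective
    ; first-adjacent  = neighbour-adjacent i
    ; second-adjacent = neighbour-adjacent j
    ; first-outside   = λ a ha≡ → ∉i (a , ha≡)
    ; second-outside  = λ b hb≡ → ∉j (b , hb≡)
    }
    where open ThreeNeighbours (three-neighbours y-centre)

  trace-outer-neighbour : ∀ {y o} → centre y ≡ true → A y o ≡ true → Outside o → trace y o ≡ true
  trace-outer-neighbour {y} {o} y-centre e out
    rewrite e | ∨-zeroʳ ⌊ o ≟ y ⌋ | inCode-outside out | bipartite e | y-centre = refl

  Separated : Fin n → Fin n → Set
  Separated y y′ = ∃[ x ] trace y x ≢ trace y′ x

  separated-sym : ∀ {y y′} → Separated y y′ → Separated y′ y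
  separated-sym (x , ≢) = x , ≢ ∘ sym

  true≢false : ∀ {a b : Bool} → a ≡ true → b ≡ false → a ≢ b
  true≢false refl refl ()

  data Kind (y : Fin n) : Set where
    in-pattern       : ∀ i → h i ≡ y → Kind y
    outer-non-centre : Outside y → centre y ≡ false → Kind y
    outer-centre     : Outside y → centre y ≡ true → Kind y

  kind : ∀ y → Kind y
  kind y with image? y
  ... | yes (i , hi≡y) = in-pattern i hi≡y
  ... | no  ∉image with centre y in y-centre
  ...   | false = outer-non-centre (λ i hi≡y → ∉image (i , hi≡y)) y-centre
  ...   | true  = outer-centre (λ i hi≡y → ∉image (i , hi≡y)) y-centre

  separated-pattern : ∀ {i y} → h i ≢ y → Kind y → Separated (h i) y
  separated-pattern {i} hi≢y (in-pattern j refl) with pattern-separating i j (hi≢y ∘ cong h)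
  ... | l , differ = h l , λ eq → differ (trans (sym (trace-h i l)) (trans eq (trace-h j l)))
  separated-pattern {i} _ (outer-non-centre out y-non-centre) =
    _ , λ eq → true≢false (trace-self out y-non-centre) (trace-h-outside i out) (sym eq)
  separated-pattern {i} _ (outer-centre out y-centre) =
    first , λ eq → true≢false (trace-outer-neighbour y-centre first-adjacent first-outside)
                              (trace-h-outside i first-outside) (sym eq)
    where open OuterNeighbours (outer-neighbours out y-centre)

  separated-non-centre-centre : ∀ {y y′} → Outside y → centre y ≡ false → centre y′ ≡ true → OuterNeighbours y′ →
                                Separated y y′
  separated-non-centre-centre {y} out y-non-centre y′-centre N with OuterNeighbours.first N ≟ y
  ... | yes refl = second , λ eq → true≢false (trace-outer-neighbour y′-centre second-adjacent second-outside)
                                     (trace-non-centre out y-non-centre (distinct ∘ sym)) (sym eq)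
    where open OuterNeighbours N
  ... | no first≢y = first , λ eq → true≢false (trace-outer-neighbour y′-centre first-adjacent first-outside)
                                     (trace-non-centre out y-non-centre first≢y) (sym eq)
    where open OuterNeighbours N

  -- y′ cannot see both outer neighbours of y: that would be a 4-cycle y, first, y′, second
  separated-centres : ∀ {y y′} → y ≢ y′ → centre y ≡ true → OuterNeighbours y → Outside y′ → centre y′ ≡ true →
                      Separated y y′
  separated-centres {y} {y′} y≢y′ y-centre N out′ y′-centre
    with trace y′ (OuterNeighbours.first N) in t₁ | trace y′ (OuterNeighbours.second N) in t₂
  ... | false | _     = _ , λ eq → true≢false (trace-outer-neighbour y-centre first-adjacent first-outside) t₁ eq
    where open OuterNeighbours N
  ... | true  | false = _ , λ eq → true≢false (trace-outer-neighbour y-centre second-adjacent second-outside) t₂ eq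
    where open OuterNeighbours N
  ... | true  | true  = contradiction
    (hop (adjacent⇒≢ first-adjacent ∘ sym) (trans (symmetric _ _) (trace-outer-centre out′ y′-centre t₁))
      (hop (y≢y′ ∘ sym) (trace-outer-centre out′ y′-centre t₂) (stop (adjacent⇒≢ second-adjacent ∘ sym))))
    (no-detour distinct first-adjacent second-adjacent)
    where open OuterNeighbours N

  separated : ∀ {y y′} → y ≢ y′ → Separated y y′
  separated {y} {y′} y≢y′ with kind y | kind y′
  ... | in-pattern i refl | k′ = separated-pattern y≢y′ k′
  ... | k | in-pattern j refl = separated-sym (separated-pattern (y≢y′ ∘ sym) k)
  ... | outer-non-centre out y-nc | outer-non-centre out′ y′-nc =
    y , λ eq → true≢false (trace-self out y-nc) (trace-non-centre out′ y′-nc y≢y′) eq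
  ... | outer-non-centre out y-nc | outer-centre out′ y′-c =
    separated-non-centre-centre out y-nc y′-c (outer-neighbours out′ y′-c)
  ... | outer-centre out y-c | outer-non-centre out′ y′-nc =
    separated-sym (separated-non-centre-centre out′ y′-nc y-c (outer-neighbours out y-c))
  ... | outer-centre out y-c | outer-centre out′ y′-c = separated-centres y≢y′ y-c (outer-neighbours out y-c) out′ y′-c

  dominated : ∀ y → ∃[ x ] trace y x ≡ true
  dominated y with kind y
  ... | in-pattern i refl with pattern-dominating i
  ...   | l , t = h l , trans (trace-h i l) t
  dominated y | outer-non-centre out y-nc = y , trace-self out y-nc
  dominated y | outer-centre out y-c = first , trace-outer-neighbour y-c first-adjacent first-outside
    where open OuterNeighbours (outer-neighbours out y-c)

  trace-lookup : ∀ y x → lookup (closedNbhd A y ∩ code) x ≡ trace y x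
  trace-lookup y x = trans (lookup-zipWith _∧_ x (closedNbhd A y) code)
                           (cong₂ _∧_ (lookup∘tabulate _ x) (lookup∘tabulate inCode x))

  identifying : IsIdentifyingCode A code
  identifying = nonempty , distinct
    where
    nonempty : ∀ y → Nonempty (closedNbhd A y ∩ code)
    nonempty y with dominated y
    ... | x , t = x , lookup⇒[]= x _ (trans (trace-lookup y x) t)
    distinct : ∀ u w → u ≢ w → closedNbhd A u ∩ code ≢ closedNbhd A w ∩ code
    distinct u w u≢w eq with separated u≢w
    ... | x , differ = differ (trans (sym (trace-lookup u x)) (trans (cong (λ p → lookup p x) eq) (trace-lookup w x)))

  -- Exchanging every pattern centre with its pendant maps the code injectively into the
  -- non-centres other than the middle spine vertex.
  relabel : Fin n → Fin n
  relabel x with image? x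
  ... | yes (i , _) = h (swap i)
  ... | no  _       = x

  relabel-injective : ∀ {x y} → relabel x ≡ relabel y → x ≡ y
  relabel-injective {x} {y} with image? x | image? y
  ... | yes (i , refl) | yes (j , refl) = λ eq → cong h (swap-injective (h-injective eq))
  ... | yes (i , refl) | no  ∉image     = λ eq → contradiction (swap i , eq) ∉image
  ... | no  ∉image     | yes (j , refl) = λ eq → contradiction (swap j , sym eq) ∉image
  ... | no  _          | no  _          = λ eq → eq

  relabel-code : ∀ x → inCode x ≡ true → delete (not ∘ centre) (h (# 4)) (relabel x) ≡ true
  relabel-code x with image? x
  ... | yes (i , refl) = λ i-code → let centre≡false , swap≢4 = swap-code i i-code in
        trans (delete-≢ (not ∘ centre) (swap≢4 ∘ h-injective)) (cong not (trans (h-centre (swap i)) centre≡false))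
  ... | no  ∉image     = λ x-code → trans (delete-≢ (not ∘ centre) (λ x≡h4 → ∉image (# 4 , sym x≡h4))) x-code

  code-size : 3 * ∣ code ∣ ≤ 2 * n
  code-size = begin
    3 * ∣ code ∣     ≤⟨ *-monoʳ-≤ 3 code≤2c ⟩
    3 * (2 * c)      ≡⟨ *-comm 3 (2 * c) ⟩
    2 * c * 3        ≡⟨ *-assoc 2 c 3 ⟩
    2 * (c * 3)      ≡⟨ cong (2 *_) (*-comm c 3) ⟩
    2 * (3 * c)      ≤⟨ *-monoʳ-≤ 2 (n≤1+n _) ⟩
    2 * suc (3 * c)  ≡⟨ cong (2 *_) order ⟨
    2 * n            ∎
    where
    open ≤-Reasoning
    c = ∣ tabulate centre ∣
    non-centres : ∣ tabulate (not ∘ centre) ∣ ≡ suc (2 * c)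
    non-centres = +-cancelˡ-≡ c _ _ (trans (∣tabulate∣+∣tabulate-not∣ centre) (trans order (sym (+-suc c (2 * c)))))
    code<non-centres : ∣ code ∣ < ∣ tabulate (not ∘ centre) ∣
    code<non-centres = begin-strict
      ∣ code ∣                                         ≤⟨ ∣tabulate∣-mono-injection relabel relabel-injective relabel-code ⟩
      ∣ tabulate (delete (not ∘ centre) (h (# 4))) ∣     <⟨ n<1+n _ ⟩
      suc ∣ tabulate (delete (not ∘ centre) (h (# 4))) ∣ ≡⟨ ∣tabulate∣-delete (not ∘ centre) middle-non-centre ⟨
      ∣ tabulate (not ∘ centre) ∣                      ∎
      where middle-non-centre = cong not (h-centre (# 4))
    code≤2c : ∣ code ∣ ≤ 2 * c
    code≤2c = ≤-pred (subst (∣ code ∣ <_) non-centres code<non-centres)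

lemma4p17 : (n : ℕ) (A : Adj n) → IsAppendedStar n A → MaxDegree A 3 →
            DiameterAtLeast A 8 → γID-atMost A (2 * n) 3
lemma4p17 n A appended (degree≤3 , _) diameter = code , identifying , code-size
  where
  S = appendedStar⇒StarTree appended degree≤3
  open StarTreeProperties S
  open SpineProperties (spine diameter)
  open IdentifyingCode S embedding
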